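{- Let $k \ge 3$ and let $T = S(d_1,\dots,d_k)$ be a spider with branch vertex $u$ and leaves $l_1,\dots,l_k$, where $d_i = d(l_i,u)$ and $d_1 \le \cdots \le d_k$. Let $t$ be a fixed integer with $1 \leq t \leq k-1$ and let $f_t$ be an independent broadcast on $T$ whose set of broadcasting vertices is exactly $\{l_t, \dots, l_k\}$. Then \[ f_t(V) \leq (d_t + d_{t+1} - 1) + \sum_{j=t+1}^{k} (d_t + d_j - 1). \]
   Context: For a graph $G$, $d(u,v)$ is the distance, $\mathrm{ecc}(v)$ the eccentricity, $\mathrm{diam}(G)$ the diameter. A broadcast on $G$ is a function $f: V(G)\to\{0,\dots,\mathrm{diam}(G)\}$ with $f(v)\le\mathrm{ecc}(v)$; its weight is $f(V)=\sum_v f(v)$. A vertex $v$ is broadcasting if $f(v)>0$; $w$ hears a broadcasting $v$ if $d(w,v)\le f(v)$. A broadcast is independent if every broadcasting vertex hears only itself. A spider $S(d_1,\dots,d_k)$ has a branch vertex $u$ of degree $k$ and $k$ leaves, the $i$-th joined to $u$ by a path of length $d_i \ge 1$, all other vertices having degree $2$. -}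

module Defs where

open import Data.Nat using (ℕ; zero; suc; _+_; _∸_; _≤_; _<_; _⊔_; ∣_-_∣)
open import Data.Fin using (Fin; toℕ; _≟_)
open import Data.Fin.Base using () renaming (_<_ to _<ᶠ_)
open import Data.List using (List; _∷_; []; map; concatMap; foldr; allFin)
open import Data.Nat.ListAction using (sum)
open import Data.Product using (Σ; ∃; _×_; _,_)
open import Relation.Nullary using (yes; no)
open import Relation.Binary.PropositionalEquality using (_≡_)
open import Function.Bundles using (_⇔_)

-- The spider S(d_0,...,d_{k-1}) (legs indexed by Fin k, 0-based).
-- Vertices: the branch vertex `hub`, and on leg i the vertex `leg i a`
-- (a : Fin (d i)) which lies at distance (toℕ a + 1) from the hub.
data SV (k : ℕ) (d : Fin k → ℕ) : Set where
  hub : SV k d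
  leg : (i : Fin k) → Fin (d i) → SV k d

module Spider (k : ℕ) (d : Fin k → ℕ) where

  V : Set
  V = SV k d

  ht : V → ℕ
  ht hub       = 0
  ht (leg i a) = suc (toℕ a)

  -- shortest-path distance in the spider (a tree): along the same leg it is
  -- the difference of heights, otherwise the path goes through the hub.
  dist : V → V → ℕ
  dist hub       w         = ht w
  dist (leg i a) hub       = suc (toℕ a)
  dist (leg i a) (leg j b) with i ≟ j
  ... | yes _ = ∣ suc (toℕ a) - suc (toℕ b) ∣
  ... | no  _ = suc (toℕ a) + suc (toℕ b)

  vertices : List V
  vertices = hub ∷ concatMap (λ i → map (leg i) (allFin (d i))) (allFin k)

  maxList : List ℕ → ℕ
  maxList = foldr _⊔_ 0

  ecc : V → ℕ
  ecc v = maxList (map (dist v) vertices)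

  diam : ℕ
  diam = maxList (map ecc vertices)

  IsLeafOf : Fin k → V → Set
  IsLeafOf i v = Σ (Fin (d i)) λ a → (v ≡ leg i a) × (suc (toℕ a) ≡ d i)

  IsBroadcast : (V → ℕ) → Set
  IsBroadcast f = (v : V) → (f v ≤ diam) × (f v ≤ ecc v)

  weight : (V → ℕ) → ℕ
  weight f = sum (map f vertices)

  Hears : (V → ℕ) → V → V → Set
  Hears f w v = (0 < f v) × (dist w v ≤ f v)

  IsIndependent : (V → ℕ) → Set
  IsIndependent f = (v w : V) → 0 < f v → Hears f v w → v ≡ w

ΣFin : (k : ℕ) → (Fin k → ℕ) → ℕ
ΣFin k g = sum (map g (allFin k))

open import Data.Bool using (if_then_else_)
open import Data.Nat using (_<ᵇ_)

ΣAbove : (k : ℕ) → ℕ → (Fin k → ℕ) → ℕ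
ΣAbove k m g = ΣFin k (λ j → if m <ᵇ toℕ j then g j else 0)

-- Independence forces a broadcasting leaf not to reach any other
-- broadcasting leaf, and two leaves on different legs are at distance d_i + d_j; so
-- f(l_i) ≤ d_t + d_i - 1 for i > t (compare with l_t) and f(l_t) ≤ d_t + d_{t+1} - 1
-- (compare with l_{t+1}). Summing over the leaves gives the bound.
module Submission where

open import Defs
open import Data.Nat using (ℕ; zero; suc; _+_; _∸_; _≤_; _<_; z≤n; z<s; pred; _<ᵇ_; >-nonZero)
open import Data.Nat.Properties
  using (≤-refl; ≤-reflexive; ≤-trans; +-mono-≤; +-comm; +-identityʳ; +-commutativeSemigroup;
         m≤m+n; suc-injective; module ≤-Reasoning; n<1+n; <⇒≤; <⇒≢; ≤∧≢⇒<; ≮⇒≥; <⇒≤pred; suc-pred; <⇒<ᵇ; _<?_)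
open import Algebra.Properties.CommutativeSemigroup +-commutativeSemigroup using (interchange)
open import Data.Nat.ListAction using (sum)
open import Data.Nat.ListAction.Properties using (sum-++)
open import Data.Fin using (Fin; toℕ; fromℕ<; _≟_) renaming (zero to fzero; suc to fsuc)
open import Data.Fin.Properties using (toℕ-injective; toℕ-fromℕ<)
import Data.Fin.Properties as Fin
open import Data.List using (List; []; _∷_; _++_; map; concatMap; tabulate; allFin)
open import Data.List.Properties using (map-++; map-tabulate; map-cong)
open import Data.Bool using (true; if_then_else_)
open import Data.Product using (Σ; _×_; _,_)
open import Data.Empty using (⊥-elim)
open import Relation.Nullary using (¬_; yes; no; does)
open import Relation.Nullary.Decidable using (dec-true; dec-false)
open import Relation.Binary.PropositionalEquality
open import Function using (_∘′_)
open import Function.Bundles using (_⇔_; Equivalence)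

sum-map-mono : ∀ {A : Set} {g h : A → ℕ} → (∀ x → g x ≤ h x) →
               (xs : List A) → sum (map g xs) ≤ sum (map h xs)
sum-map-mono g≤h []       = z≤n
sum-map-mono g≤h (x ∷ xs) = +-mono-≤ (g≤h x) (sum-map-mono g≤h xs)

sum-map-+ : ∀ {A : Set} (g h : A → ℕ) (xs : List A) →
            sum (map (λ x → g x + h x) xs) ≡ sum (map g xs) + sum (map h xs)
sum-map-+ g h []       = refl
sum-map-+ g h (x ∷ xs) = trans (cong ((g x + h x) +_) (sum-map-+ g h xs))
  (interchange (g x) (h x) (sum (map g xs)) (sum (map h xs)))

≤-from-positive : ∀ {m n} → (0 < m → m ≤ n) → m ≤ n
≤-from-positive {zero}  _     = z≤n
≤-from-positive {suc m} 0<m⇒ = 0<m⇒ z<s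

if-<ᵇ-true : ∀ {A : Set} {m n} {x y : A} → m < n → (if m <ᵇ n then x else y) ≡ x
if-<ᵇ-true {m = m} {n} m<n with m <ᵇ n | <⇒<ᵇ m<n
... | true | _ = refl

sum-map-concatMap : ∀ {A B : Set} (g : B → ℕ) (h : A → List B) (xs : List A) →
                    sum (map g (concatMap h xs)) ≡ sum (map (λ x → sum (map g (h x))) xs)
sum-map-concatMap g h []       = refl
sum-map-concatMap g h (x ∷ xs) = begin
  sum (map g (h x ++ concatMap h xs))               ≡⟨ cong sum (map-++ g (h x) (concatMap h xs)) ⟩
  sum (map g (h x) ++ map g (concatMap h xs))       ≡⟨ sum-++ (map g (h x)) _ ⟩
  sum (map g (h x)) + sum (map g (concatMap h xs))  ≡⟨ cong (sum (map g (h x)) +_) (sum-map-concatMap g h xs) ⟩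
  sum (map g (h x)) + sum (map (λ x → sum (map g (h x))) xs) ∎
  where open ≡-Reasoning

sum-tabulate-zero : ∀ {n} (g : Fin n → ℕ) → (∀ b → g b ≡ 0) → sum (tabulate g) ≡ 0
sum-tabulate-zero {zero}  g g≡0 = refl
sum-tabulate-zero {suc n} g g≡0 =
  cong₂ _+_ (g≡0 fzero) (sum-tabulate-zero (λ b → g (fsuc b)) (λ b → g≡0 (fsuc b)))

sum-tabulate-single : ∀ {n} (g : Fin n → ℕ) (a : Fin n) → (∀ b → b ≢ a → g b ≡ 0) →
                      sum (tabulate g) ≡ g a
sum-tabulate-single {suc n} g fzero g≡0 = begin
  g fzero + sum (tabulate (λ b → g (fsuc b)))  ≡⟨ cong (g fzero +_) (sum-tabulate-zero _ (λ b → g≡0 (fsuc b) λ ())) ⟩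
  g fzero + 0                                  ≡⟨ +-identityʳ (g fzero) ⟩
  g fzero                                      ∎
  where open ≡-Reasoning
sum-tabulate-single {suc n} g (fsuc a) g≡0 =
  cong₂ _+_ (g≡0 fzero λ ())
            (sum-tabulate-single (λ b → g (fsuc b)) a (λ b b≢a → g≡0 (fsuc b) (b≢a ∘′ Fin.suc-injective)))

module _ {k : ℕ} {d : Fin k → ℕ} where
  open Spider k d

  leg-injectiveˡ : ∀ {i j : Fin k} {a : Fin (d i)} {b : Fin (d j)} →
                   _≡_ {A = V} (leg i a) (leg j b) → i ≡ j
  leg-injectiveˡ refl = refl

  independent⇒<dist : ∀ {f : V → ℕ} {v w : V} → IsIndependent f →
                      0 < f v → 0 < f w → w ≢ v → f v < dist w v
  independent⇒<dist {f} {v} {w} indep fv>0 fw>0 w≢v with f v <? dist w v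
  ... | yes fv<dist = fv<dist
  ... | no  fv≮dist = ⊥-elim (w≢v (indep w v fw>0 (fv>0 , ≮⇒≥ fv≮dist)))

module SpiderLeaves (k : ℕ) (d : Fin k → ℕ) (d≥1 : ∀ i → 1 ≤ d i) where
  open Spider k d

  private
    suc-pred-d : ∀ i → suc (pred (d i)) ≡ d i
    suc-pred-d i = suc-pred (d i) {{>-nonZero (d≥1 i)}}

  leafIndex : (i : Fin k) → Fin (d i)
  leafIndex i = fromℕ< (≤-reflexive (suc-pred-d i))

  suc-toℕ-leafIndex : ∀ i → suc (toℕ (leafIndex i)) ≡ d i
  suc-toℕ-leafIndex i = trans (cong suc (toℕ-fromℕ< _)) (suc-pred-d i)

  leaf : Fin k → V
  leaf i = leg i (leafIndex i)

  leaf-isLeafOf : ∀ i → IsLeafOf i (leaf i)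
  leaf-isLeafOf i = leafIndex i , refl , suc-toℕ-leafIndex i

  isLeafOf-leg⇒leafIndex : ∀ {i j} {a : Fin (d i)} → IsLeafOf j (leg i a) → a ≡ leafIndex i
  isLeafOf-leg⇒leafIndex (a , refl , suc-a≡d) =
    toℕ-injective (suc-injective (trans suc-a≡d (sym (suc-toℕ-leafIndex _))))

  dist-leaf-leaf : ∀ {i j} → i ≢ j → dist (leaf i) (leaf j) ≡ d i + d j
  dist-leaf-leaf {i} {j} i≢j with i ≟ j
  ... | yes i≡j = ⊥-elim (i≢j i≡j)
  ... | no  _   = cong₂ _+_ (suc-toℕ-leafIndex i) (suc-toℕ-leafIndex j)

  independent-leaf-bound : ∀ {f : V → ℕ} {i j} → IsIndependent f → i ≢ j →
                           0 < f (leaf i) → 0 < f (leaf j) → f (leaf i) ≤ d i + d j ∸ 1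
  independent-leaf-bound {f} {i} {j} indep i≢j fi>0 fj>0 =
    <⇒≤pred (subst (f (leaf i) <_) (trans (dist-leaf-leaf (i≢j ∘′ sym)) (+-comm (d j) (d i)))
      (independent⇒<dist indep fi>0 fj>0 (λ e → i≢j (sym (leg-injectiveˡ e)))))

  weight≡sum-leaves : ∀ {f : V → ℕ} → (∀ v → 0 < f v → Σ (Fin k) λ i → IsLeafOf i v) →
                      weight f ≡ ΣFin k (λ i → f (leaf i))
  weight≡sum-leaves {f} onLeaves = begin
    f hub + sum (map f (concatMap legVertices (allFin k)))
      ≡⟨ cong₂ _+_ f-hub (sum-map-concatMap f legVertices (allFin k)) ⟩
    0 + ΣFin k (λ i → sum (map f (legVertices i)))
      ≡⟨ cong sum (map-cong leg-sum (allFin k)) ⟩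
    ΣFin k (λ i → f (leaf i)) ∎
    where
    open ≡-Reasoning
    legVertices : Fin k → List V
    legVertices i = map (leg i) (allFin (d i))

    vanishes : ∀ v → ¬ (Σ (Fin k) λ i → IsLeafOf i v) → f v ≡ 0
    vanishes v notLeaf with f v in fv
    ... | zero  = refl
    ... | suc _ = ⊥-elim (notLeaf (onLeaves v (subst (0 <_) (sym fv) z<s)))

    f-hub : f hub ≡ 0
    f-hub = vanishes hub λ { (_ , _ , () , _) }

    leg-sum : ∀ i → sum (map f (legVertices i)) ≡ f (leaf i)
    leg-sum i = begin
      sum (map f (map (leg i) (allFin (d i))))  ≡⟨ cong (λ xs → sum (map f xs)) (map-tabulate (λ a → a) (leg i)) ⟩
      sum (map f (tabulate (leg i)))            ≡⟨ cong sum (map-tabulate (leg i) f) ⟩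
      sum (tabulate (λ a → f (leg i a)))        ≡⟨ sum-tabulate-single _ (leafIndex i)
                                                     (λ a a≢l → vanishes (leg i a) λ { (_ , isLeaf) → a≢l (isLeafOf-leg⇒leafIndex isLeaf) }) ⟩
      f (leaf i)                                ∎

mainTheorem19 : (k : ℕ) → 3 ≤ k →
    (d : Fin k → ℕ) → ((i : Fin k) → 1 ≤ d i) →
    ((i j : Fin k) → toℕ i ≤ toℕ j → d i ≤ d j) →
    (t : Fin k) → (ht1 : suc (toℕ t) < k) →
    (f : SV k d → ℕ) →
    Spider.IsBroadcast k d f →
    Spider.IsIndependent k d f →
    ((v : SV k d) → (0 < f v) ⇔ (Σ (Fin k) λ i → (toℕ t ≤ toℕ i) × Spider.IsLeafOf k d i v)) →
    Spider.weight k d f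
    ≤ (d t + d (fromℕ< ht1) ∸ 1)
    + ΣAbove k (toℕ t) (λ j → d t + d j ∸ 1)
mainTheorem19 k _ d d≥1 _ t t+1<k f _ indep broadcasting⇔ = begin
  weight f                              ≡⟨ weight≡sum-leaves onLeaves ⟩
  ΣFin k (λ i → f (leaf i))             ≤⟨ sum-map-mono leaf-bound (allFin k) ⟩
  ΣFin k (λ i → atT i + above i)        ≡⟨ sum-map-+ atT above (allFin k) ⟩
  ΣFin k atT + ΣFin k above             ≡⟨ cong (_+ ΣFin k above) sum-atT ⟩
  C + ΣAbove k (toℕ t) (λ j → d t + d j ∸ 1) ∎
  where
  open ≤-Reasoning
  open Spider k d
  open SpiderLeaves k d d≥1

  next : Fin k
  next = fromℕ< t+1<k

  C : ℕ
  C = d t + d next ∸ 1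

  atT : Fin k → ℕ
  atT i = if does (i ≟ t) then C else 0

  above : Fin k → ℕ
  above i = if toℕ t <ᵇ toℕ i then d t + d i ∸ 1 else 0

  sum-atT : ΣFin k atT ≡ C
  sum-atT = trans (cong sum (map-tabulate (λ i → i) atT))
    (trans (sum-tabulate-single atT t (λ i i≢t → cong (if_then C else 0) (dec-false (i ≟ t) i≢t)))
           (cong (if_then C else 0) (dec-true (t ≟ t) refl)))

  onLeaves : ∀ v → 0 < f v → Σ (Fin k) λ i → IsLeafOf i v
  onLeaves v fv>0 with Equivalence.to (broadcasting⇔ v) fv>0
  ... | i , _ , isLeaf = i , isLeaf

  broadcasting : ∀ i → toℕ t ≤ toℕ i → 0 < f (leaf i)
  broadcasting i t≤i = Equivalence.from (broadcasting⇔ (leaf i)) (i , t≤i , leaf-isLeafOf i)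

  broadcasting⇒t≤ : ∀ i → 0 < f (leaf i) → toℕ t ≤ toℕ i
  broadcasting⇒t≤ i fi>0 with Equivalence.to (broadcasting⇔ (leaf i)) fi>0
  ... | j , t≤j , (_ , leaf≡leg , _) = subst (λ j → toℕ t ≤ toℕ j) (sym (leg-injectiveˡ leaf≡leg)) t≤j

  t<next : toℕ t < toℕ next
  t<next = subst (toℕ t <_) (sym (toℕ-fromℕ< t+1<k)) (n<1+n (toℕ t))

  t≢next : t ≢ next
  t≢next = <⇒≢ t<next ∘′ cong toℕ

  leaf-bound : ∀ i → f (leaf i) ≤ atT i + above i
  leaf-bound i with i ≟ t
  ... | yes refl = ≤-from-positive λ ft>0 → ≤-trans
        (independent-leaf-bound indep t≢next ft>0 (broadcasting next (<⇒≤ t<next)))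
        (m≤m+n C (above t))
  ... | no i≢t = ≤-from-positive λ fi>0 →
        let t<i = ≤∧≢⇒< (broadcasting⇒t≤ i fi>0) (λ e → i≢t (sym (toℕ-injective e)))
        in begin
          f (leaf i)        ≤⟨ independent-leaf-bound indep i≢t fi>0 (broadcasting t ≤-refl) ⟩
          d i + d t ∸ 1     ≡⟨ cong (_∸ 1) (+-comm (d i) (d t)) ⟩
          d t + d i ∸ 1     ≡⟨ sym (if-<ᵇ-true t<i) ⟩
          above i           ∎
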